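{- Let $\mathcal R$ be a polarized rewrite system such that $\longrightarrow_{ - }$ and $\longrightarrow_{+}$ commute. If $\pi$ is a proof-term of $\Gamma \vdash_{\mathcal R} A$ and $A \longrightarrow_{ - } A'$, then $\pi$ is also a proof-term of $\Gamma \vdash_{\mathcal R} A'$.
   Context: Propositions are built from atomic propositions (propositional symbols) and the constant $\bot$ using the binary connectives $\Rightarrow$, $\wedge$, $\vee$; $\neg A$ abbreviates $A \Rightarrow \bot$. A rewrite rule is a pair $P \longrightarrow A$ with $P$ an atomic proposition and $A$ an arbitrary proposition. A polarized rewrite system $\mathcal R = \langle \mathcal R_{ - }, \mathcal R_{+}\rangle$ is a pair of sets of rewrite rules; rules of $\mathcal R_{ - }$ are called negative, those of $\mathcal R_{+}$ positive. The one-step relations $\longrightarrow^1_{ - }$, $\longrightarrow^1_{+}$ are the least relations on propositions such that: $P \longrightarrow^1_{ - } A$ for every negative rule $P \longrightarrow A$; $P \longrightarrow^1_{+} A$ for every positive rule $P\longrightarrow A$; $A \Rightarrow B \longrightarrow^1_{ - } A' \Rightarrow B$ if $A \longrightarrow^1_{+} A'$, and $A \Rightarrow B \longrightarrow^1_{ - } A \Rightarrow B'$ if $B \longrightarrow^1_{ - } B'$; $A \Rightarrow B \longrightarrow^1_{+} A' \Rightarrow B$ if $A \longrightarrow^1_{ - } A'$, and $A \Rightarrow B \longrightarrow^1_{+} A \Rightarrow B'$ if $B \longrightarrow^1_{+} B'$; for $\circ \in \{\wedge, \vee\}$ and $s \in \{ -,+\}$, $A \circ B \longrightarrow^1_{s}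 A' \circ B$ if $A \longrightarrow^1_{s} A'$, and $A \circ B \longrightarrow^1_{s} A \circ B'$ if $B \longrightarrow^1_{s} B'$. The relations $\longrightarrow_{ - }$, $\longrightarrow_{+}$ are the reflexive-transitive closures of $\longrightarrow^1_{ - }$, $\longrightarrow^1_{+}$; $B \longleftarrow_{s} A$ means $A \longrightarrow_{s} B$. The relations $\longrightarrow_{ - }$ and $\longrightarrow_{+}$ commute if whenever $A \longleftarrow_{ - } B \longrightarrow_{+} C$ there is a proposition $D$ with $A \longrightarrow_{+} D \longleftarrow_{ - } C$. Proof-terms: $\pi ::= \alpha \mid \lambda\alpha\,\pi \mid (\pi_1\,\pi_2) \mid \langle \pi_1,\pi_2\rangle \mid \mathit{fst}(\pi) \mid \mathit{snd}(\pi) \mid i(\pi) \mid j(\pi) \mid \delta(\pi_1, \alpha\pi_2, \beta\pi_3) \mid \delta_\bot(\pi)$, with $\alpha,\beta$ proof variables ($\lambda\alpha$ binds $\alpha$; in $\delta(\pi_1,\alpha\pi_2,\beta\pi_3)$, $\alpha$ is bound in $\pi_2$ and $\beta$ in $\pi_3$). A context $\Gamma$ is a finite set of declarations $\alpha : B$ of distinct proof variables. "$\pi$ is a proof-term of $\Gamma \vdash_{\mathcal R} A$" (polarized natural deduction modulo $\mathcal R$) is defined inductively: (axiom) $\alpha$ is a proof-term of $\Gamma \vdash_{\mathcal R} A$ if $\alpha:B \in \Gamma$ and $B \longrightarrow_{ - } C \longleftarrow_{+} A$ for some $C$; ($\Rightarrow$-intro) if $\pi$ is a proof-term of $\Gamma,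 \alpha:A \vdash_{\mathcal R} B$ and $C \longrightarrow_{+} (A \Rightarrow B)$ then $\lambda\alpha\,\pi$ is one of $\Gamma \vdash_{\mathcal R} C$; ($\Rightarrow$-elim) if $\pi_1$ is one of $\Gamma\vdash_{\mathcal R} C$ with $C \longrightarrow_{ - } (A \Rightarrow B)$ and $\pi_2$ one of $\Gamma \vdash_{\mathcal R} A$, then $(\pi_1\,\pi_2)$ is one of $\Gamma \vdash_{\mathcal R} B$; ($\wedge$-intro) if $\pi_1$ is one of $\Gamma \vdash_{\mathcal R} A$, $\pi_2$ one of $\Gamma\vdash_{\mathcal R} B$ and $C \longrightarrow_{+} (A\wedge B)$, then $\langle\pi_1,\pi_2\rangle$ is one of $\Gamma \vdash_{\mathcal R} C$; ($\wedge$-elim) if $\pi$ is one of $\Gamma \vdash_{\mathcal R} C$ and $C \longrightarrow_{ - } (A \wedge B)$ then $\mathit{fst}(\pi)$ is one of $\Gamma\vdash_{\mathcal R} A$ and $\mathit{snd}(\pi)$ one of $\Gamma \vdash_{\mathcal R} B$; ($\vee$-intro) if $\pi$ is one of $\Gamma\vdash_{\mathcal R} A$ (resp. $\Gamma \vdash_{\mathcal R} B$) and $C \longrightarrow_{+} (A \vee B)$ then $i(\pi)$ (resp. $j(\pi)$) is one of $\Gamma \vdash_{\mathcal R} C$; ($\vee$-elim) if $\pi_1$ is one of $\Gamma\vdash_{\mathcal R} D$ with $D \longrightarrow_{ - } (A\vee B)$, $\pi_2$ one of $\Gamma,\alpha:A \vdash_{\mathcal R} C$ and $\pi_3$ one of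 $\Gamma,\beta:B\vdash_{\mathcal R} C$, then $\delta(\pi_1,\alpha\pi_2,\beta\pi_3)$ is one of $\Gamma \vdash_{\mathcal R} C$; ($\bot$-elim) if $\pi$ is one of $\Gamma \vdash_{\mathcal R} B$ with $B \longrightarrow_{ - } \bot$ then $\delta_\bot(\pi)$ is one of $\Gamma \vdash_{\mathcal R} A$ for every $A$. -}

module Defs where

open import Data.Product using (Σ; _×_; _,_; ∃-syntax)
open import Data.List using (List; []; _∷_; map)
open import Data.List.Membership.Propositional using (_∈_; _∉_)
open import Relation.Binary.Construct.Closure.ReflexiveTransitive using (Star)

data Prop (Atom : Set) : Set where
  atom : Atom → Prop Atom
  ⊥'   : Prop Atom
  _⇒_  : Prop Atom → Prop Atom → Prop Atom
  _∧_  : Prop Atom → Prop Atom → Prop Atom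
  _∨_  : Prop Atom → Prop Atom → Prop Atom

infixr 5 _⇒_
infixr 6 _∨_
infixr 7 _∧_

RuleSet : Set → Set₁
RuleSet Atom = Atom → Prop Atom → Set

record Polarized (Atom : Set) : Set₁ where
  constructor ⟨_,_⟩
  field
    neg : RuleSet Atom
    pos : RuleSet Atom

open Polarized public

data Sign : Set where
  - + : Sign

flip : Sign → Sign
flip - = +
flip + = -

rules : ∀ {Atom} → Polarized Atom → Sign → RuleSet Atom
rules R - = neg R
rules R + = pos R

data Step {Atom : Set} (R : Polarized Atom) : Sign → Prop Atom → Prop Atom → Set where
  rule : ∀ {s P A} → rules R s P A → Step R s (atom P) A
  ⇒l   : ∀ {s A A' B} → Step R (flip s) A A' → Step R s (A ⇒ B) (A' ⇒ B)
  ⇒r   : ∀ {s A B B'} → Step R s B B' → Step R s (A ⇒ B) (A ⇒ B')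
  ∧l   : ∀ {s A A' B} → Step R s A A' → Step R s (A ∧ B) (A' ∧ B)
  ∧r   : ∀ {s A B B'} → Step R s B B' → Step R s (A ∧ B) (A ∧ B')
  ∨l   : ∀ {s A A' B} → Step R s A A' → Step R s (A ∨ B) (A' ∨ B)
  ∨r   : ∀ {s A B B'} → Step R s B B' → Step R s (A ∨ B) (A ∨ B')

Red : ∀ {Atom} → Polarized Atom → Sign → Prop Atom → Prop Atom → Set
Red R s = Star (Step R s)

Commute : ∀ {Atom} → Polarized Atom → Set
Commute R = ∀ {A B C} → Red R - B A → Red R + B C →
            ∃[ D ] (Red R + A D × Red R - C D)

data Term (Var : Set) : Set where
  var    : Var → Term Var
  lam    : Var → Term Var → Term Var
  app    : Term Var → Term Var → Term Var
  pair   : Term Var → Term Var → Term Var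
  fst    : Term Var → Term Var
  snd    : Term Var → Term Var
  inl    : Term Var → Term Var
  inr    : Term Var → Term Var
  case   : Term Var → Var → Term Var → Var → Term Var → Term Var
  δ⊥     : Term Var → Term Var

-- Contexts: finite lists of declarations α : B with pairwise distinct variables
-- (distinctness is maintained by only extending with fresh variables).
Ctx : Set → Set → Set
Ctx Var Atom = List (Σ Var (λ _ → Prop Atom))

dom : ∀ {Var Atom} → Ctx Var Atom → List Var
dom = map (λ d → Data.Product.proj₁ d)

data Proof {Var Atom : Set} (R : Polarized Atom) :
           Ctx Var Atom → Term Var → Prop Atom → Set where
  ax     : ∀ {Γ α A B C} → (α , B) ∈ Γ → Red R - B C → Red R + A C →
           Proof R Γ (var α) A
  ⇒I     : ∀ {Γ α π A B C} → α ∉ dom Γ → Proof R ((α , A) ∷ Γ) π B →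
           Red R + C (A ⇒ B) → Proof R Γ (lam α π) C
  ⇒E     : ∀ {Γ π₁ π₂ A B C} → Proof R Γ π₁ C → Red R - C (A ⇒ B) →
           Proof R Γ π₂ A → Proof R Γ (app π₁ π₂) B
  ∧I     : ∀ {Γ π₁ π₂ A B C} → Proof R Γ π₁ A → Proof R Γ π₂ B →
           Red R + C (A ∧ B) → Proof R Γ (pair π₁ π₂) C
  ∧E₁    : ∀ {Γ π A B C} → Proof R Γ π C → Red R - C (A ∧ B) →
           Proof R Γ (fst π) A
  ∧E₂    : ∀ {Γ π A B C} → Proof R Γ π C → Red R - C (A ∧ B) →
           Proof R Γ (snd π) B
  ∨I₁    : ∀ {Γ π A B C} → Proof R Γ π A → Red R + C (A ∨ B) →
           Proof R Γ (inl π) C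
  ∨I₂    : ∀ {Γ π A B C} → Proof R Γ π B → Red R + C (A ∨ B) →
           Proof R Γ (inr π) C
  ∨E     : ∀ {Γ π₁ π₂ π₃ α β A B C D} → Proof R Γ π₁ D → Red R - D (A ∨ B) →
           α ∉ dom Γ → Proof R ((α , A) ∷ Γ) π₂ C →
           β ∉ dom Γ → Proof R ((β , B) ∷ Γ) π₃ C →
           Proof R Γ (case π₁ α π₂ β π₃) C
  ⊥E     : ∀ {Γ π A B} → Proof R Γ π B → Red R - B ⊥' →
           Proof R Γ (δ⊥ π) A

-- A derivation of Γ ⊢ A is rebuilt over Γ' ⊢ A' by induction, where A ⟶₋ A' and each
-- hypothesis of Γ' is a positive reduct of the one in Γ. Elimination rules only need a
-- longer negative reduction of the major premise; introduction rules and axioms need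
-- commutation to close a peak of ⟶₋ against ⟶₊, and reductions of a compound
-- proposition act componentwise, with polarity flipped left of ⇒.
module Submission where

open import Defs
open import Data.List using ([]; _∷_)
open import Data.List.Relation.Unary.Any using (here; there)
open import Data.List.Relation.Unary.Unique.Propositional using (Unique)
open import Data.List.Membership.Propositional using (_∈_; _∉_)
open import Data.Product using (_×_; _,_; ∃-syntax)
open import Relation.Binary.Construct.Closure.ReflexiveTransitive using (ε; _◅_; _◅◅_; gmap)
open import Relation.Binary.PropositionalEquality using (_≡_; refl; cong; subst)

module _ {Atom : Set} (R : Polarized Atom) where

  ⇒-red-inv : ∀ {s A B X} → Red R s (A ⇒ B) X →
              ∃[ A' ] ∃[ B' ] (X ≡ A' ⇒ B' × Red R (flip s) A A' × Red R s B B')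
  ⇒-red-inv ε = _ , _ , refl , ε , ε
  ⇒-red-inv (⇒l a ◅ r) with ⇒-red-inv r
  ... | A' , B' , refl , aa' , bb' = A' , B' , refl , a ◅ aa' , bb'
  ⇒-red-inv (⇒r b ◅ r) with ⇒-red-inv r
  ... | A' , B' , refl , aa' , bb' = A' , B' , refl , aa' , b ◅ bb'

  ∧-red-inv : ∀ {s A B X} → Red R s (A ∧ B) X →
              ∃[ A' ] ∃[ B' ] (X ≡ A' ∧ B' × Red R s A A' × Red R s B B')
  ∧-red-inv ε = _ , _ , refl , ε , ε
  ∧-red-inv (∧l a ◅ r) with ∧-red-inv r
  ... | A' , B' , refl , aa' , bb' = A' , B' , refl , a ◅ aa' , bb'
  ∧-red-inv (∧r b ◅ r) with ∧-red-inv r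
  ... | A' , B' , refl , aa' , bb' = A' , B' , refl , aa' , b ◅ bb'

  ∨-red-inv : ∀ {s A B X} → Red R s (A ∨ B) X →
              ∃[ A' ] ∃[ B' ] (X ≡ A' ∨ B' × Red R s A A' × Red R s B B')
  ∨-red-inv ε = _ , _ , refl , ε , ε
  ∨-red-inv (∨l a ◅ r) with ∨-red-inv r
  ... | A' , B' , refl , aa' , bb' = A' , B' , refl , a ◅ aa' , bb'
  ∨-red-inv (∨r b ◅ r) with ∨-red-inv r
  ... | A' , B' , refl , aa' , bb' = A' , B' , refl , aa' , b ◅ bb'

  -- Closes the peaks B' ⟵₊ B ⟶₋ C, then A' ⟵₋ A ⟶₊ C, then the one left over C.
  axiom-red : Commute R → ∀ {A A' B B' C} →
              Red R - B C → Red R + A C → Red R + B B' → Red R - A A' →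
              ∃[ D ] (Red R - B' D × Red R + A' D)
  axiom-red com bc ac bb' aa' with com bc bb' | com aa' ac
  ... | E , cE , b'E | D , a'D , cD with com cD cE
  ... | F , DF , EF = F , b'E ◅◅ EF , a'D ◅◅ DF

  data CtxRed {Var : Set} : Ctx Var Atom → Ctx Var Atom → Set where
    []  : CtxRed [] []
    _∷_ : ∀ {α B B' Γ Γ'} → Red R + B B' → CtxRed Γ Γ' →
          CtxRed ((α , B) ∷ Γ) ((α , B') ∷ Γ')

  module _ {Var : Set} where

    CtxRed-refl : ∀ (Γ : Ctx Var Atom) → CtxRed Γ Γ
    CtxRed-refl []      = []
    CtxRed-refl (_ ∷ Γ) = ε ∷ CtxRed-refl Γ

    CtxRed-dom : ∀ {Γ Γ' : Ctx Var Atom} → CtxRed Γ Γ' → dom Γ ≡ dom Γ'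
    CtxRed-dom []                   = refl
    CtxRed-dom (_∷_ {α = α} _ Γ⟶Γ') = cong (α ∷_) (CtxRed-dom Γ⟶Γ')

    CtxRed-∉ : ∀ {Γ Γ' : Ctx Var Atom} {α} → CtxRed Γ Γ' → α ∉ dom Γ → α ∉ dom Γ'
    CtxRed-∉ Γ⟶Γ' = subst (λ αs → _ ∉ αs) (CtxRed-dom Γ⟶Γ')

    CtxRed-∈ : ∀ {Γ Γ' : Ctx Var Atom} {α B} → CtxRed Γ Γ' → (α , B) ∈ Γ →
               ∃[ B' ] ((α , B') ∈ Γ' × Red R + B B')
    CtxRed-∈ (bb' ∷ _)    (here refl) = _ , here refl , bb'
    CtxRed-∈ (_ ∷ Γ⟶Γ') (there m) with CtxRed-∈ Γ⟶Γ' m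
    ... | B' , m' , bb' = B' , there m' , bb'

    Proof-resp-red : Commute R → ∀ {Γ Γ' π A A'} →
                     Proof R Γ π A → CtxRed Γ Γ' → Red R - A A' → Proof R Γ' π A'
    Proof-resp-red com (ax m bc ac) Γ⟶Γ' aa' with CtxRed-∈ Γ⟶Γ' m
    ... | _ , m' , bb' with axiom-red com bc ac bb' aa'
    ... | _ , b'D , a'D = ax m' b'D a'D
    Proof-resp-red com (⇒I α∉ p r) Γ⟶Γ' cc' with com cc' r
    ... | _ , c'D , abD with ⇒-red-inv abD
    ... | _ , _ , refl , aa' , bb' =
      ⇒I (CtxRed-∉ Γ⟶Γ' α∉) (Proof-resp-red com p (aa' ∷ Γ⟶Γ') bb') c'D
    Proof-resp-red com (⇒E p r q) Γ⟶Γ' bb' =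
      ⇒E (Proof-resp-red com p Γ⟶Γ' ε) (r ◅◅ gmap _ ⇒r bb') (Proof-resp-red com q Γ⟶Γ' ε)
    Proof-resp-red com (∧I p q r) Γ⟶Γ' cc' with com cc' r
    ... | _ , c'D , abD with ∧-red-inv abD
    ... | _ , _ , refl , aa' , bb' =
      ∧I (Proof-resp-red com p Γ⟶Γ' aa') (Proof-resp-red com q Γ⟶Γ' bb') c'D
    Proof-resp-red com (∧E₁ p r) Γ⟶Γ' aa' =
      ∧E₁ (Proof-resp-red com p Γ⟶Γ' ε) (r ◅◅ gmap _ ∧l aa')
    Proof-resp-red com (∧E₂ p r) Γ⟶Γ' bb' =
      ∧E₂ (Proof-resp-red com p Γ⟶Γ' ε) (r ◅◅ gmap _ ∧r bb')
    Proof-resp-red com (∨I₁ p r) Γ⟶Γ' cc' with com cc' r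
    ... | _ , c'D , abD with ∨-red-inv abD
    ... | _ , _ , refl , aa' , _ = ∨I₁ (Proof-resp-red com p Γ⟶Γ' aa') c'D
    Proof-resp-red com (∨I₂ p r) Γ⟶Γ' cc' with com cc' r
    ... | _ , c'D , abD with ∨-red-inv abD
    ... | _ , _ , refl , _ , bb' = ∨I₂ (Proof-resp-red com p Γ⟶Γ' bb') c'D
    Proof-resp-red com (∨E p r α∉ q₁ β∉ q₂) Γ⟶Γ' cc' =
      ∨E (Proof-resp-red com p Γ⟶Γ' ε) r
         (CtxRed-∉ Γ⟶Γ' α∉) (Proof-resp-red com q₁ (ε ∷ Γ⟶Γ') cc')
         (CtxRed-∉ Γ⟶Γ' β∉) (Proof-resp-red com q₂ (ε ∷ Γ⟶Γ') cc')
    Proof-resp-red com (⊥E p r) Γ⟶Γ' _ = ⊥E (Proof-resp-red com p Γ⟶Γ' ε) r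

proposition1 : {Var Atom : Set} (R : Polarized Atom) → Commute R →
               (Γ : Ctx Var Atom) → Unique (dom Γ) →
               (π : Term Var) (A A' : Prop Atom) →
               Proof R Γ π A → Red R - A A' → Proof R Γ π A'
proposition1 R com Γ _ _ _ _ p = Proof-resp-red R com p (CtxRed-refl R Γ)
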